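{- Let $\{u,v\}$ be a nontrivial 2-cut in a graph $G$. Then: (i) $G$ has three internally disjoint $uv$-paths; (ii) if $S\subseteq V(G)-\{u,v\}$ and $|S|\le 2$, then $u$ and $v$ lie in the same component of $G-S$; (iii) if $\{x,y\}$ is a nontrivial 2-cut of $G$ distinct from $\{u,v\}$, then $u$ and $v$ lie in a unique $\{x,y\}$-bridge.
   Context: All graphs are simple and finite. For $S\subseteq V(G)$, an $S$-bridge of $G$ is either an edge joining two vertices of $S$ (trivial bridge) or a component of $G-S$ together with all edges joining it to $S$ (nontrivial bridge). For two vertices $u,v$, $c(G,uv)$ denotes the number of nontrivial $\{u,v\}$-bridges that contain both $u$ and $v$. A nontrivial 2-cut is a set $\{u,v\}$ of two vertices with $c(G,uv)\ge 3$. -}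

module Defs where

open import Data.Nat using (ℕ; _≤_)
open import Data.Fin using (Fin)
open import Data.Bool using (Bool; T)
open import Data.List using (List; []; _∷_; _++_)
open import Data.List.Relation.Unary.Linked using (Linked)
open import Data.List.Relation.Unary.Unique.Propositional using (Unique)
open import Data.List.Relation.Binary.Disjoint.Propositional using (Disjoint)
open import Data.Product using (Σ; ∃; _×_; _,_)
open import Data.Sum using (_⊎_)
open import Data.Empty using (⊥)
open import Relation.Nullary using (¬_)
open import Relation.Binary.PropositionalEquality using (_≡_; _≢_)

record Graph (n : ℕ) : Set where
  field
    adj    : Fin n → Fin n → Bool
    sym    : ∀ a b → T (adj a b) → T (adj b a)
    irrefl : ∀ a → ¬ T (adj a a)

module _ {n : ℕ} (G : Graph n) where
  open Graph G

  Adj : Fin n → Fin n → Set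
  Adj a b = T (adj a b)

  -- Reach S a b : a and b lie in the same component of G - S
  -- (a walk from a to b all of whose vertices avoid S).
  data Reach (S : Fin n → Set) : Fin n → Fin n → Set where
    here : ∀ {a} → ¬ S a → Reach S a a
    step : ∀ {a b c} → ¬ S a → Adj a b → Reach S b c → Reach S a c

  Pair : Fin n → Fin n → Fin n → Set
  Pair u v w = (w ≡ u) ⊎ (w ≡ v)

  -- S-bridges: a trivial bridge is an edge ab with a,b ∈ S; a nontrivial
  -- bridge is represented by any vertex r of the component of G - S.
  data Bridge : Set where
    trivial    : Fin n → Fin n → Bridge
    nontrivial : Fin n → Bridge

  ValidBridge : (Fin n → Set) → Bridge → Set
  ValidBridge S (trivial a b)  = S a × S b × Adj a b
  ValidBridge S (nontrivial r) = ¬ S r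

  SameBridge : (Fin n → Set) → Bridge → Bridge → Set
  SameBridge S (trivial a b)  (trivial a' b') = (a ≡ a' × b ≡ b') ⊎ (a ≡ b' × b ≡ a')
  SameBridge S (nontrivial r) (nontrivial r') = Reach S r r'
  SameBridge S _ _ = ⊥

  InBridge : (Fin n → Set) → Fin n → Bridge → Set
  InBridge S w (trivial a b)  = (w ≡ a) ⊎ (w ≡ b)
  InBridge S w (nontrivial r) =
    (¬ S w × Reach S r w) ⊎ (S w × ∃ λ c → Reach S r c × Adj c w)

  NontrivBridgeUV : Fin n → Fin n → Fin n → Set
  NontrivBridgeUV u v r =
    ValidBridge (Pair u v) (nontrivial r)
    × InBridge (Pair u v) u (nontrivial r)
    × InBridge (Pair u v) v (nontrivial r)

  NontrivialTwoCut : Fin n → Fin n → Set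
  NontrivialTwoCut u v =
    u ≢ v ×
    Σ (Fin n) λ r₁ → Σ (Fin n) λ r₂ → Σ (Fin n) λ r₃ →
      NontrivBridgeUV u v r₁ × NontrivBridgeUV u v r₂ × NontrivBridgeUV u v r₃
      × ¬ SameBridge (Pair u v) (nontrivial r₁) (nontrivial r₂)
      × ¬ SameBridge (Pair u v) (nontrivial r₁) (nontrivial r₃)
      × ¬ SameBridge (Pair u v) (nontrivial r₂) (nontrivial r₃)

  -- A uv-path, given by its list of internal vertices is:
  -- the vertex sequence u ∷ is ++ [v] has no repetition and
  -- consecutive vertices are adjacent.
  IsPath : Fin n → Fin n → List (Fin n) → Set
  IsPath u v is = Unique (u ∷ is ++ v ∷ []) × Linked Adj (u ∷ is ++ v ∷ [])

  ThreeInternallyDisjointPaths : Fin n → Fin n → Set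
  ThreeInternallyDisjointPaths u v =
    Σ (List (Fin n)) λ p₁ → Σ (List (Fin n)) λ p₂ → Σ (List (Fin n)) λ p₃ →
      IsPath u v p₁ × IsPath u v p₂ × IsPath u v p₃
      × p₁ ≢ p₂ × p₁ ≢ p₃ × p₂ ≢ p₃
      × Disjoint p₁ p₂ × Disjoint p₁ p₃ × Disjoint p₂ p₃

  UniqueBridgeContaining : (Fin n → Set) → Fin n → Fin n → Set
  UniqueBridgeContaining S u v =
    Σ Bridge λ B →
      ValidBridge S B × InBridge S u B × InBridge S v B
      × (∀ B' → ValidBridge S B' → InBridge S u B' → InBridge S v B' →
           SameBridge S B' B)

module Submission where

-- Every nontrivial {u,v}-bridge B containing u and v yields a "connector":
-- neighbours a of u and b of v joined by a walk inside B - {u,v}.  Two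
-- observations about the three bridges drive everything.
--   * Loop-erasing the three connectors gives three uv-paths; their interior
--     vertices lie in three different components of G - {u,v}, so the paths
--     are internally disjoint (part (i)).
--   * For any decidable vertex set T, either some connector avoids T, or each
--     connector meets T, and then T contains three distinct vertices (one in
--     each component).  A set of at most two vertices (part (ii)), or the pair
--     {x,y} of another 2-cut (part (iii)), cannot contain three distinct
--     vertices, so a connector avoiding it exists.  In (iii) such a connector
--     puts u and v into the {x,y}-bridge of whichever of them lies outside
--     {x,y}, and that bridge is the only one containing it.

open import Defs
open import Data.Nat using (ℕ; _≤_)
open import Data.Fin using (Fin)
open import Data.Fin.Subset using (Subset; _∈_; ∣_∣)
open import Data.Product using (_×_)
open import Data.Sum using (_⊎_)
open import Relation.Nullary using (¬_)
open import Relation.Binary.PropositionalEquality using (_≡_; _≢_)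

open import Data.Nat using (z≤n; s≤s)
open import Data.Nat.Properties using (≤-trans)
open import Data.Fin using (_≟_)
open import Data.Fin.Subset using (_-_)
open import Data.Fin.Subset.Properties using (_∈?_; x∈p⇒∣p-x∣<∣p∣; x∈p∧x≢y⇒x∈p-y)
open import Data.List using (List; []; _∷_; _++_; length)
open import Data.List.Relation.Unary.Any using (any?; here; there)
open import Data.List.Relation.Unary.All using (All; []; _∷_)
import Data.List.Relation.Unary.All as All
open import Data.List.Relation.Unary.All.Properties using (¬Any⇒All¬; ++⁺)
open import Data.List.Relation.Unary.AllPairs using ([]; _∷_)
open import Data.List.Relation.Unary.Linked using (Linked; [-]; _∷_)
open import Data.List.Relation.Unary.Unique.Propositional using (Unique)
import Data.List.Relation.Unary.Unique.Propositional.Properties as Unique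
open import Data.List.Relation.Binary.Disjoint.Propositional using (Disjoint)
open import Data.List.Membership.Propositional using () renaming (_∈_ to _∈ᴸ_)
open import Data.Product using (Σ; _,_; proj₁; proj₂; map₂)
open import Data.Sum using (inj₁; inj₂)
open import Data.Empty using (⊥-elim)
open import Relation.Nullary using (yes; no)
open import Relation.Nullary.Decidable using (_⊎-dec_)
open import Relation.Unary using (Decidable)
open import Relation.Binary.PropositionalEquality using (refl; sym; trans)
open import Function using (_∘_)

distinct-members≤size : ∀ {n} {p : Subset n} {xs : List (Fin n)} →
  Unique xs → All (_∈ p) xs → length xs ≤ ∣ p ∣
distinct-members≤size [] [] = z≤n
distinct-members≤size {p = p} {x ∷ xs} (x≢xs ∷ unique) (x∈p ∷ xs⊆p) =
  ≤-trans (s≤s (distinct-members≤size unique xs⊆p-x)) (x∈p⇒∣p-x∣<∣p∣ x∈p)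
  where
  xs⊆p-x : All (_∈ p - x) xs
  xs⊆p-x = All.zipWith (λ (y∈p , x≢y) → x∈p∧x≢y⇒x∈p-y y∈p (x≢y ∘ sym)) (xs⊆p , x≢xs)

record ThreeDistinct {n : ℕ} (T : Fin n → Set) : Set where
  constructor three
  field
    {w₁ w₂ w₃} : Fin n
    in₁ : T w₁
    in₂ : T w₂
    in₃ : T w₃
    w₁≢w₂ : w₁ ≢ w₂
    w₁≢w₃ : w₁ ≢ w₃
    w₂≢w₃ : w₂ ≢ w₃

small-subset-no-three : ∀ {n} (S : Subset n) → ∣ S ∣ ≤ 2 → ¬ ThreeDistinct (_∈ S)
small-subset-no-three S ∣S∣≤2 (three {w₁} {w₂} {w₃} in₁ in₂ in₃ d₁₂ d₁₃ d₂₃)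
  with ≤-trans (distinct-members≤size distinct (in₁ ∷ in₂ ∷ in₃ ∷ [])) ∣S∣≤2
  where
  distinct : Unique (w₁ ∷ w₂ ∷ w₃ ∷ [])
  distinct = (d₁₂ ∷ d₁₃ ∷ []) ∷ (d₂₃ ∷ []) ∷ [] ∷ []
... | s≤s (s≤s ())

pair-no-three : ∀ {n} (G : Graph n) {x y : Fin n} → ¬ ThreeDistinct (Pair G x y)
pair-no-three G (three (inj₁ a) (inj₁ b) _ d _ _) = d (trans a (sym b))
pair-no-three G (three (inj₂ a) (inj₂ b) _ d _ _) = d (trans a (sym b))
pair-no-three G (three (inj₁ a) _ (inj₁ b) _ d _) = d (trans a (sym b))
pair-no-three G (three (inj₂ a) _ (inj₂ b) _ d _) = d (trans a (sym b))
pair-no-three G (three _ (inj₁ a) (inj₁ b) _ _ d) = d (trans a (sym b))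
pair-no-three G (three _ (inj₂ a) (inj₂ b) _ _ d) = d (trans a (sym b))

pair-members : ∀ {n} (G : Graph n) {x y u v : Fin n} → u ≢ v →
  Pair G x y u → Pair G x y v → (x ≡ u × y ≡ v) ⊎ (x ≡ v × y ≡ u)
pair-members G u≢v (inj₁ u≡x) (inj₁ v≡x) = ⊥-elim (u≢v (trans u≡x (sym v≡x)))
pair-members G u≢v (inj₂ u≡y) (inj₂ v≡y) = ⊥-elim (u≢v (trans u≡y (sym v≡y)))
pair-members G u≢v (inj₁ u≡x) (inj₂ v≡y) = inj₁ (sym u≡x , sym v≡y)
pair-members G u≢v (inj₂ u≡y) (inj₁ v≡x) = inj₂ (sym v≡x , sym u≡y)

module _ {n : ℕ} (G : Graph n) where
  open Graph G using () renaming (sym to adj-sym)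

  module _ {S : Fin n → Set} where
    walk-start : ∀ {a b} → Reach G S a b → ¬ S a
    walk-start (here a∉S) = a∉S
    walk-start (step a∉S _ _) = a∉S

    walk-end : ∀ {a b} → Reach G S a b → ¬ S b
    walk-end (here b∉S) = b∉S
    walk-end (step _ _ walk) = walk-end walk

    _++ʷ_ : ∀ {a b c} → Reach G S a b → Reach G S b c → Reach G S a c
    here _ ++ʷ walk = walk
    step a∉S ab walk ++ʷ walk′ = step a∉S ab (walk ++ʷ walk′)

    reverse-walk : ∀ {a b} → Reach G S a b → Reach G S b a
    reverse-walk (here a∉S) = here a∉S
    reverse-walk (step a∉S ab walk) =
      reverse-walk walk ++ʷ step (walk-start walk) (adj-sym _ _ ab) (here a∉S)

    vertices : ∀ {a b} → Reach G S a b → List (Fin n)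
    vertices {a} (here _) = a ∷ []
    vertices {a} (step _ _ walk) = a ∷ vertices walk

    first∈vertices : ∀ {a b} (walk : Reach G S a b) → a ∈ᴸ vertices walk
    first∈vertices (here _) = here refl
    first∈vertices (step _ _ _) = here refl

    vertices-reachable : ∀ {a b} (walk : Reach G S a b) → All (Reach G S a) (vertices walk)
    vertices-reachable (here a∉S) = here a∉S ∷ []
    vertices-reachable (step a∉S ab walk) =
      here a∉S ∷ All.map (step a∉S ab) (vertices-reachable walk)

    vertices-linked : ∀ {x a b y} (walk : Reach G S a b) → Adj G x a → Adj G b y →
      Linked (Adj G) (x ∷ vertices walk ++ y ∷ [])
    vertices-linked (here _) xa by = xa ∷ by ∷ [-]
    vertices-linked (step _ ab walk) xa by = xa ∷ vertices-linked walk ab by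

    suffix-from : ∀ {a b c} (walk : Reach G S c b) → a ∈ᴸ vertices walk →
      Σ (Reach G S a b) λ suffix → Unique (vertices walk) → Unique (vertices suffix)
    suffix-from walk@(here _) (here refl) = walk , λ unique → unique
    suffix-from walk@(step _ _ _) (here refl) = walk , λ unique → unique
    suffix-from (step _ _ walk) (there a∈walk) =
      map₂ (λ keep → λ { (_ ∷ unique) → keep unique }) (suffix-from walk a∈walk)

    loop-erase : ∀ {a b} → Reach G S a b → Σ (Reach G S a b) (Unique ∘ vertices)
    loop-erase (here a∉S) = here a∉S , [] ∷ []
    loop-erase {a} (step a∉S ab walk) with loop-erase walk
    ... | path , unique with any? (a ≟_) (vertices path)
    ...   | yes a∈path = map₂ (λ keep → keep unique) (suffix-from path a∈path)
    ...   | no a∉path = step a∉S ab path , ¬Any⇒All¬ _ a∉path ∷ unique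

  pair? : ∀ x y → Decidable (Pair G x y)
  pair? x y w = (w ≟ x) ⊎-dec (w ≟ y)

  avoid-or-hit : ∀ {P T : Fin n → Set} → Decidable T → ∀ {a b} → Reach G P a b →
    Reach G T a b ⊎ Σ (Fin n) λ w → T w × Reach G P a w
  avoid-or-hit T? {a} walk with T? a
  avoid-or-hit T? {a} walk | yes a∈T = inj₂ (a , a∈T , here (walk-start walk))
  avoid-or-hit T? (here _) | no a∉T = inj₁ (here a∉T)
  avoid-or-hit T? (step a∉P ab walk) | no a∉T with avoid-or-hit T? walk
  ... | inj₁ avoiding = inj₁ (step a∉T ab avoiding)
  ... | inj₂ (w , w∈T , hit) = inj₂ (w , w∈T , step a∉P ab hit)

  bridge-of-outside-vertex : ∀ {T : Fin n → Set} {z} → ¬ T z →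
    ∀ B → ValidBridge G T B → InBridge G T z B → SameBridge G T B (nontrivial z)
  bridge-of-outside-vertex z∉T (trivial a b) (a∈T , _) (inj₁ refl) = ⊥-elim (z∉T a∈T)
  bridge-of-outside-vertex z∉T (trivial a b) (_ , b∈T , _) (inj₂ refl) = ⊥-elim (z∉T b∈T)
  bridge-of-outside-vertex z∉T (nontrivial r) _ (inj₁ (_ , r↝z)) = r↝z
  bridge-of-outside-vertex z∉T (nontrivial r) _ (inj₂ (z∈T , _)) = ⊥-elim (z∉T z∈T)

  swap-unique-bridge : ∀ {T : Fin n → Set} {u v} →
    UniqueBridgeContaining G T v u → UniqueBridgeContaining G T u v
  swap-unique-bridge (B , valid , v∈B , u∈B , only) =
    B , valid , u∈B , v∈B , λ B′ valid′ u∈B′ v∈B′ → only B′ valid′ v∈B′ u∈B′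

  record Connector (T : Fin n → Set) (u v : Fin n) : Set where
    constructor connector
    field
      {first last} : Fin n
      u~first : Adj G u first
      last~v : Adj G last v
      walk : Reach G T first last

  reverse-connector : ∀ {T u v} → Connector T u v → Connector T v u
  reverse-connector (connector u~a b~v walk) =
    connector (adj-sym _ _ b~v) (adj-sym _ _ u~a) (reverse-walk walk)

  walk-to-last : ∀ {T u v} (c : Connector T u v) → ¬ T u → Reach G T u (Connector.last c)
  walk-to-last (connector u~a _ walk) u∉T = step u∉T u~a walk

  walk-through : ∀ {T u v} → Connector T u v → ¬ T u → ¬ T v → Reach G T u v
  walk-through c u∉T v∉T =
    walk-to-last c u∉T ++ʷ step (walk-end (Connector.walk c)) (Connector.last~v c) (here v∉T)

  connector⇒unique-bridge : ∀ {T u v} → Decidable T → Connector T u v → ¬ T u →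
    UniqueBridgeContaining G T u v
  connector⇒unique-bridge {T} {u} {v} T? c u∉T =
    nontrivial u , u∉T , inj₁ (u∉T , here u∉T) , v∈bridge ,
    λ B valid u∈B _ → bridge-of-outside-vertex u∉T B valid u∈B
    where
    v∈bridge : InBridge G T v (nontrivial u)
    v∈bridge with T? v
    ... | no v∉T = inj₁ (v∉T , walk-through c u∉T v∉T)
    ... | yes v∈T = inj₂ (v∈T , Connector.last c , walk-to-last c u∉T , Connector.last~v c)

  module _ {u v : Fin n} where
    private
      P : Fin n → Set
      P = Pair G u v

    bridge-connector : ∀ {r} → NontrivBridgeUV G u v r →
      Σ (Connector P u v) λ c → Reach G P r (Connector.first c)
    bridge-connector (_ , inj₁ (u∉P , _) , _) = ⊥-elim (u∉P (inj₁ refl))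
    bridge-connector (_ , inj₂ _ , inj₁ (v∉P , _)) = ⊥-elim (v∉P (inj₂ refl))
    bridge-connector (_ , inj₂ (_ , _ , r↝a , a~u) , inj₂ (_ , _ , r↝b , b~v)) =
      connector (adj-sym _ _ a~u) b~v (reverse-walk r↝a ++ʷ r↝b) , r↝a

    separated : ∀ {r r′ w w′} → Reach G P r w → Reach G P r′ w′ →
      ¬ SameBridge G P (nontrivial r) (nontrivial r′) → w ≢ w′
    separated r↝w r′↝w′ r≁r′ refl = r≁r′ (r↝w ++ʷ reverse-walk r′↝w′)

    separated-disjoint : ∀ {r r′ xs ys} → All (Reach G P r) xs → All (Reach G P r′) ys →
      ¬ SameBridge G P (nontrivial r) (nontrivial r′) → Disjoint xs ys
    separated-disjoint r↝xs r′↝ys r≁r′ (z∈xs , z∈ys) =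
      separated (All.lookup r↝xs z∈xs) (All.lookup r′↝ys z∈ys) r≁r′ refl

    bridge-path : ∀ {r} → u ≢ v → NontrivBridgeUV G u v r →
      Σ (List (Fin n)) λ is → IsPath G u v is × All (Reach G P r) is × Σ (Fin n) (_∈ᴸ is)
    bridge-path {r} u≢v bridge with bridge-connector bridge
    ... | connector u~a b~v walk , r↝a with loop-erase walk
    ...   | path , unique =
      vertices path , (distinct , vertices-linked path u~a b~v) ,
      r↝path , _ , first∈vertices path
      where
      r↝path : All (Reach G P r) (vertices path)
      r↝path = All.map (r↝a ++ʷ_) (vertices-reachable path)
      outside : All (λ z → ¬ P z) (vertices path)
      outside = All.map walk-end r↝path
      distinct : Unique (u ∷ vertices path ++ v ∷ [])
      distinct =
        ++⁺ (All.map (λ z∉P u≡z → z∉P (inj₁ (sym u≡z))) outside) (u≢v ∷ [])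
        ∷ Unique.++⁺ unique ([] ∷ [])
            λ { (z∈path , here refl) → All.lookup outside z∈path (inj₂ refl) }

    bridge-avoids-or-meets : ∀ {T r} → Decidable T → NontrivBridgeUV G u v r →
      Connector T u v ⊎ Σ (Fin n) λ w → T w × Reach G P r w
    bridge-avoids-or-meets T? bridge with bridge-connector bridge
    ... | connector u~a b~v walk , r↝a with avoid-or-hit T? walk
    ...   | inj₁ avoiding = inj₁ (connector u~a b~v avoiding)
    ...   | inj₂ (w , w∈T , a↝w) = inj₂ (w , w∈T , r↝a ++ʷ a↝w)

    connector-or-three : ∀ {T} → Decidable T → NontrivialTwoCut G u v →
      Connector T u v ⊎ ThreeDistinct T
    connector-or-three T? (_ , _ , _ , _ , b₁ , b₂ , b₃ , s₁₂ , s₁₃ , s₂₃)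
      with bridge-avoids-or-meets T? b₁ | bridge-avoids-or-meets T? b₂
         | bridge-avoids-or-meets T? b₃
    ... | inj₁ c | _ | _ = inj₁ c
    ... | inj₂ _ | inj₁ c | _ = inj₁ c
    ... | inj₂ _ | inj₂ _ | inj₁ c = inj₁ c
    ... | inj₂ (_ , t₁ , r↝w₁) | inj₂ (_ , t₂ , r↝w₂) | inj₂ (_ , t₃ , r↝w₃) =
      inj₂ (three t₁ t₂ t₃ (separated r↝w₁ r↝w₂ s₁₂) (separated r↝w₁ r↝w₃ s₁₃)
                           (separated r↝w₂ r↝w₃ s₂₃))

    -- Part (i): the three bridge paths are internally disjoint, hence also
    -- pairwise distinct (their interiors are nonempty).
    three-paths : NontrivialTwoCut G u v → ThreeInternallyDisjointPaths G u v
    three-paths (u≢v , _ , _ , _ , b₁ , b₂ , b₃ , s₁₂ , s₁₃ , s₂₃)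
      with bridge-path u≢v b₁ | bridge-path u≢v b₂ | bridge-path u≢v b₃
    ... | p₁ , path₁ , in₁ , z₁ | p₂ , path₂ , in₂ , z₂ | p₃ , path₃ , in₃ , _ =
      p₁ , p₂ , p₃ , path₁ , path₂ , path₃ ,
      distinct d₁₂ z₁ , distinct d₁₃ z₁ , distinct d₂₃ z₂ , d₁₂ , d₁₃ , d₂₃
      where
      d₁₂ = separated-disjoint in₁ in₂ s₁₂
      d₁₃ = separated-disjoint in₁ in₃ s₁₃
      d₂₃ = separated-disjoint in₂ in₃ s₂₃
      distinct : ∀ {xs ys} → Disjoint xs ys → Σ (Fin n) (_∈ᴸ xs) → xs ≢ ys
      distinct disjoint (_ , z∈xs) refl = disjoint (z∈xs , z∈xs)

    not-separated : NontrivialTwoCut G u v → ∀ (S : Subset n) →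
      (∀ w → w ∈ S → w ≢ u × w ≢ v) → ∣ S ∣ ≤ 2 → Reach G (_∈ S) u v
    not-separated cut S S-avoids ∣S∣≤2 with connector-or-three (_∈? S) cut
    ... | inj₁ c = walk-through c (λ u∈S → proj₁ (S-avoids u u∈S) refl)
                                  (λ v∈S → proj₂ (S-avoids v v∈S) refl)
    ... | inj₂ blockers = ⊥-elim (small-subset-no-three S ∣S∣≤2 blockers)

    unique-bridge : NontrivialTwoCut G u v → ∀ x y →
      ¬ ((x ≡ u × y ≡ v) ⊎ (x ≡ v × y ≡ u)) → UniqueBridgeContaining G (Pair G x y) u v
    unique-bridge cut x y other with connector-or-three (pair? x y) cut
    ... | inj₂ blockers = ⊥-elim (pair-no-three G blockers)
    ... | inj₁ c with pair? x y u | pair? x y v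
    ...   | no u∉xy | _ = connector⇒unique-bridge (pair? x y) c u∉xy
    ...   | yes _ | no v∉xy =
      swap-unique-bridge (connector⇒unique-bridge (pair? x y) (reverse-connector c) v∉xy)
    ...   | yes u∈xy | yes v∈xy = ⊥-elim (other (pair-members G (proj₁ cut) u∈xy v∈xy))

lemma2p1 : ∀ {n : ℕ} (G : Graph n) (u v : Fin n) → NontrivialTwoCut G u v →
    ThreeInternallyDisjointPaths G u v
    × (∀ (S : Subset n) → (∀ w → w ∈ S → w ≢ u × w ≢ v) → ∣ S ∣ ≤ 2 →
         Reach G (λ w → w ∈ S) u v)
    × (∀ (x y : Fin n) → NontrivialTwoCut G x y →
         ¬ ((x ≡ u × y ≡ v) ⊎ (x ≡ v × y ≡ u)) →
         UniqueBridgeContaining G (Pair G x y) u v)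
lemma2p1 G u v cut =
  three-paths G cut , not-separated G cut , λ x y _ → unique-bridge G cut x y
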